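{- Let $G$ be an oriented graph derived from a Burling tree $T$. Let $u,v,w$ be three vertices of $G$ appearing in this order along a branch of $T$. Then every path (not necessarily directed) in $G$ from $u$ to $w$ goes through an in-neighbour of $v$ in $G$. In particular, $N^-[v]$ is a full in-star cutset of $G$ and $N[v]$ is a full star cutset of $G$, each separating $u$ and $w$.
   Context: Rooted trees: for a rooted tree $(T,r)$ and $v\neq r$, $p(v)$ is the parent of $v$. A branch is a path $v_1v_2\dots v_k$ of $T$ with $v_i$ the parent of $v_{i+1}$ for all $i$ (it starts at $v_1$); a branch may be empty. A Burling tree is a 4-tuple $(T,r,\ell,c)$ where $T$ is a rooted tree with root $r$; $\ell$ assigns to every non-leaf vertex $v$ one of its children $\ell(v)$, the last-born of $v$; and $c$ is a function on $V(T)$ such that if $v\neq r$ is not a last-born then $c(v)$ is the vertex set of a (possibly empty) branch of $T$ starting at $\ell(p(v))$, while $c(v)=\varnothing$ if $v$ is the root or a last-born. The oriented graph fully derived from the Burling tree has vertex set $V(T)$ and an arc $uv$ iff $v\in c(u)$. An oriented graph is derived from the Burling tree if it is an induced subgraph of the fully derived oriented graph. $N^-[v]$ is $v$ together with its in-neighbours, $N[v]$ is $v$ together with all its neighbours. A full in-star cutset is a set $N^-[v]$ with $G\setminus N^-[v]$ disconnected; a full star cutset is a set $N[v]$ with $G\setminus N[v]$ disconnected. A set $X$ separates $a$ and $b$ if $a,b$ lie in distinct connected components of $G\setminus X$. -}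

module Defs where

open import Data.Nat using (ℕ; zero; suc)
open import Data.Fin using (Fin)
open import Data.Maybe using (just)
open import Data.List using (List; []; _∷_; head)
open import Data.List.Membership.Propositional using (_∈_)
open import Data.List.Relation.Unary.Unique.Propositional using (Unique)
open import Data.Product using (Σ; ∃; ∃-syntax; _×_; _,_)
open import Data.Sum using (_⊎_)
open import Relation.Nullary using (¬_)
open import Relation.Binary.PropositionalEquality using (_≡_; _≢_)

iter : ∀ {A : Set} → (A → A) → ℕ → A → A
iter f zero x = x
iter f (suc k) x = f (iter f k x)

-- The parent of the root is set to the root itself (a dummy value);
-- every vertex reaches the root by iterating the parent map, so the
-- structure is a tree rooted at 'root'.
record RootedTree (n : ℕ) : Set where
  field
    root     : Fin n
    par      : Fin n → Fin n
    par-root : par root ≡ root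
    reach    : ∀ v → ∃[ k ] iter par k v ≡ root

module _ {n : ℕ} (T : RootedTree n) where
  open RootedTree T

  Parent : Fin n → Fin n → Set
  Parent x y = (y ≢ root) × (par y ≡ x)

  IsLeaf : Fin n → Set
  IsLeaf v = ∀ y → ¬ Parent v y

  data IsBranch : List (Fin n) → Set where
    br-nil  : IsBranch []
    br-one  : ∀ x → IsBranch (x ∷ [])
    br-cons : ∀ {x y xs} → Parent x y → IsBranch (y ∷ xs) → IsBranch (x ∷ y ∷ xs)

-- A Burling tree (T, r, ℓ, c).  c(v) is given as the list of vertices of
-- a (possibly empty) branch; the vertex set is list membership.
record BurlingTree (n : ℕ) : Set where
  field
    tree : RootedTree n
  open RootedTree tree public
  field
    lb       : Fin n → Fin n
    lb-child : ∀ v → ¬ IsLeaf tree v → Parent tree v (lb v)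
    c        : Fin n → List (Fin n)
    c-empty  : ∀ v → (v ≡ root ⊎ ((v ≢ root) × (lb (par v) ≡ v))) → c v ≡ []
    c-branch : ∀ v → v ≢ root → lb (par v) ≢ v →
               IsBranch tree (c v) × (c v ≡ [] ⊎ head (c v) ≡ just (lb (par v)))

module _ {n : ℕ} (B : BurlingTree n) where
  open BurlingTree B

  FArc : Fin n → Fin n → Set
  FArc x y = y ∈ c x

  -- underlying undirected adjacency (vertex membership handled separately)
  FAdj : Fin n → Fin n → Set
  FAdj x y = FArc x y ⊎ FArc y x

  -- The derived graph G is the induced subgraph on vertex set S.
  -- x is an in-neighbour of v in G
  InNbr : (S : Fin n → Set) → Fin n → Fin n → Set
  InNbr S v x = S x × FArc x v

  ClosedInNbhd : (S : Fin n → Set) → Fin n → Fin n → Set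
  ClosedInNbhd S v x = x ≡ v ⊎ InNbr S v x

  ClosedNbhd : (S : Fin n → Set) → Fin n → Fin n → Set
  ClosedNbhd S v x = x ≡ v ⊎ (S x × FAdj x v)

data Walk {n : ℕ} (P : Fin n → Set) (E : Fin n → Fin n → Set)
     : Fin n → Fin n → List (Fin n) → Set where
  w-end  : ∀ {a} → P a → Walk P E a a (a ∷ [])
  w-step : ∀ {a b c xs} → P a → E a b → Walk P E b c xs → Walk P E a c (a ∷ xs)

IsPath : ∀ {n} (P : Fin n → Set) (E : Fin n → Fin n → Set) →
         Fin n → Fin n → List (Fin n) → Set
IsPath P E a b xs = Walk P E a b xs × Unique xs

Minus : ∀ {n} → (Fin n → Set) → (Fin n → Set) → Fin n → Set
Minus S X x = S x × ¬ X x

Separates : ∀ {n} (S : Fin n → Set) (E : Fin n → Fin n → Set) →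
            (Fin n → Set) → Fin n → Fin n → Set
Separates S E X a b =
  Minus S X a × Minus S X b × ¬ (∃[ xs ] IsPath (Minus S X) E a b xs)

{-# OPTIONS --safe #-}
-- Write x ≼ y when x is an ancestor of y.  An arc x → y of a Burling tree goes from
-- x into the branch c(x) hanging below ℓ(p(x)), a sibling of x; hence x and y are
-- incomparable, and every ancestor of y is either in c(x) or a proper ancestor of x.
-- Consequently, along any walk ending strictly below v, stepping back over an edge
-- either stays strictly below v or starts at an in-neighbour of v.  A walk from u
-- (above v) to w (below v) must therefore pass through an in-neighbour of v, and u, w,
-- being comparable with v, are not adjacent to it.
module Submission where

open import Defs
open import Data.Nat using (ℕ; zero; suc; _+_; _≤_)
open import Data.Nat.Properties using (+-comm; ≤-total; m≤n⇒∃[o]m+o≡n)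
open import Data.Fin using (Fin)
open import Data.Fin.Properties using (_≟_)
open import Data.Maybe using (just)
open import Data.List using (List; []; _∷_; head)
open import Data.List.Membership.Propositional using (_∈_)
open import Data.List.Relation.Unary.Any using (here; there)
open import Data.List.Relation.Binary.Sublist.Propositional using (_⊆_; _∷_; _∷ʳ_)
open import Data.List.Relation.Binary.Sublist.Propositional.Properties using (Any-resp-⊆; ∷ˡ⁻)
open import Data.Product using (∃-syntax; _×_; _,_; proj₁; map₂)
open import Data.Sum using (_⊎_; inj₁; inj₂; swap; reduce) renaming (map to ⊎-map)
open import Function using (_∘_)
open import Data.Empty using (⊥; ⊥-elim)
open import Relation.Nullary using (¬_; yes; no)
open import Relation.Binary.PropositionalEquality
  using (_≡_; _≢_; refl; sym; trans; cong; subst; ≢-sym; module ≡-Reasoning)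

private variable
  A : Set

iter-comm : (f : A → A) (k : ℕ) (x : A) → iter f k (f x) ≡ f (iter f k x)
iter-comm f zero    x = refl
iter-comm f (suc k) x = cong f (iter-comm f k x)

iter-+ : (f : A → A) (i j : ℕ) (x : A) → iter f (i + j) x ≡ iter f i (iter f j x)
iter-+ f zero    j x = refl
iter-+ f (suc i) j x = cong f (iter-+ f i j x)

iter-fixed : (f : A → A) (k : ℕ) {x : A} → f x ≡ x → iter f k x ≡ x
iter-fixed f zero    fx≡x = refl
iter-fixed f (suc k) fx≡x = trans (cong f (iter-fixed f k fx≡x)) fx≡x

∉-≡[] : {x : A} {xs : List A} → xs ≡ [] → ¬ x ∈ xs
∉-≡[] refl ()

head≡just : {xs : List A} {h : A} → head xs ≡ just h → ∃[ t ] xs ≡ h ∷ t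
head≡just {xs = _ ∷ t} refl = t , refl

module Ancestry {n : ℕ} (T : RootedTree n) where
  open RootedTree T

  private variable
    x y z h : Fin n
    t ys br : List (Fin n)

  infix 4 _≼_ _≺_

  _≼_ : Fin n → Fin n → Set
  x ≼ y = ∃[ i ] iter par i y ≡ x

  -- par root = root is a dummy value, hence the conjunct y ≢ root.
  _≺_ : Fin n → Fin n → Set
  x ≺ y = y ≢ root × x ≼ par y

  Comparable : Fin n → Fin n → Set
  Comparable x y = x ≼ y ⊎ y ≼ x

  ≼-refl : x ≼ x
  ≼-refl = 0 , refl

  ≼-trans : x ≼ y → y ≼ z → x ≼ z
  ≼-trans {z = z} (i , refl) (j , refl) = i + j , iter-+ par i j z

  par-≼ : par x ≼ x
  par-≼ = 1 , refl

  ≼-par : x ≼ y → par x ≼ par y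
  ≼-par {y = y} (i , refl) = i , iter-comm par i y

  ≼-root : x ≼ root → x ≡ root
  ≼-root (i , refl) = iter-fixed par i par-root

  parent⇒≺ : Parent T x y → x ≺ y
  parent⇒≺ (y≢r , py≡x) = y≢r , 0 , py≡x

  ≺⇒≼ : x ≺ y → x ≼ y
  ≺⇒≼ (_ , x≼py) = ≼-trans x≼py par-≼

  ≼⇒≡⊎≺ : x ≼ y → x ≡ y ⊎ x ≺ y
  ≼⇒≡⊎≺ (zero , refl) = inj₁ refl
  ≼⇒≡⊎≺ {y = y} (suc i , e) with y ≟ root
  ... | yes refl = inj₁ (≼-root (suc i , e))
  ... | no y≢r   = inj₂ (y≢r , i , trans (iter-comm par i y) e)

  ≼-≺-trans : x ≼ y → y ≺ z → x ≺ z
  ≼-≺-trans x≼y (z≢r , y≼pz) = z≢r , ≼-trans x≼y y≼pz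

  ≺-≼-trans : x ≺ y → y ≼ z → x ≺ z
  ≺-≼-trans (y≢r , x≼py) y≼z =
    (λ { refl → y≢r (≼-root y≼z) }) , ≼-trans x≼py (≼-par y≼z)

  ≺-trans : x ≺ y → y ≺ z → x ≺ z
  ≺-trans x≺y = ≼-≺-trans (≺⇒≼ x≺y)

  -- Iterating par from x reaches the root, and x ≼ par x would keep x an ancestor of every iterate.
  ≺-irrefl : ¬ x ≺ x
  ≺-irrefl {x} (x≢r , x≼px) with reach x
  ... | k , pᵏx≡r = x≢r (≼-root (subst (x ≼_) pᵏx≡r (≼-iter k)))
    where
    ≼-iter : ∀ k → x ≼ iter par k x
    ≼-iter zero    = ≼-refl
    ≼-iter (suc k) = ≼-trans x≼px (≼-par (≼-iter k))

  iter-par-≼ : {i j : ℕ} → i ≤ j → iter par j z ≼ iter par i z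
  iter-par-≼ {z} {i} i≤j with m≤n⇒∃[o]m+o≡n i≤j
  ... | k , refl = k , (begin
    iter par k (iter par i z) ≡⟨ iter-+ par k i z ⟨
    iter par (k + i) z        ≡⟨ cong (λ m → iter par m z) (+-comm k i) ⟩
    iter par (i + k) z        ∎)
    where open ≡-Reasoning

  ancestors-comparable : x ≼ z → y ≼ z → Comparable x y
  ancestors-comparable (i , refl) (j , refl) with ≤-total i j
  ... | inj₁ i≤j = inj₂ (iter-par-≼ i≤j)
  ... | inj₂ j≤i = inj₁ (iter-par-≼ j≤i)

  siblings-not-≼ : par x ≡ par y → x ≢ y → x ≢ root → ¬ x ≼ y
  siblings-not-≼ px≡py x≢y x≢r x≼y with ≼⇒≡⊎≺ x≼y
  ... | inj₁ x≡y         = x≢y x≡y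
  ... | inj₂ (_ , x≼py) = ≺-irrefl (x≢r , subst (_ ≼_) (sym px≡py) x≼py)

  siblings-no-common-descendant :
    par x ≡ par y → x ≢ y → x ≢ root → y ≢ root → x ≼ z → y ≼ z → ⊥
  siblings-no-common-descendant px≡py x≢y x≢r y≢r x≼z y≼z
    with ancestors-comparable x≼z y≼z
  ... | inj₁ x≼y = siblings-not-≼ px≡py x≢y x≢r x≼y
  ... | inj₂ y≼x = siblings-not-≼ (sym px≡py) (≢-sym x≢y) y≢r y≼x

  branch-head-≼ : IsBranch T (h ∷ t) → x ∈ h ∷ t → h ≼ x
  branch-head-≼ _                    (here refl) = ≼-refl
  branch-head-≼ (br-cons h-par rest) (there x∈)  =
    ≼-trans (≺⇒≼ (parent⇒≺ h-par)) (branch-head-≼ rest x∈)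

  branch-ancestor : IsBranch T (h ∷ t) → x ∈ h ∷ t → y ≼ x → y ∈ h ∷ t ⊎ y ≺ h
  branch-ancestor _ (here refl) y≼x with ≼⇒≡⊎≺ y≼x
  ... | inj₁ refl = inj₁ (here refl)
  ... | inj₂ y≺h  = inj₂ y≺h
  branch-ancestor {y = y} (br-cons (_ , ph′≡h) rest) (there x∈) y≼x
    with branch-ancestor rest x∈ y≼x
  ... | inj₁ y∈ = inj₁ (there y∈)
  ... | inj₂ (_ , y≼ph′) with ≼⇒≡⊎≺ (subst (y ≼_) ph′≡h y≼ph′)
  ...   | inj₁ refl = inj₁ (here refl)
  ...   | inj₂ y≺h  = inj₂ y≺h

  branch-⊆⇒≺ : IsBranch T br → (x ∷ y ∷ ys) ⊆ br → x ≺ y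
  branch-⊆⇒≺ (br-one _)           (_ ∷ʳ ())
  branch-⊆⇒≺ (br-cons _ rest)     (_ ∷ʳ σ) = branch-⊆⇒≺ rest σ
  branch-⊆⇒≺ (br-cons h-par rest) (refl ∷ σ) =
    ≺-≼-trans (parent⇒≺ h-par) (branch-head-≼ rest (Any-resp-⊆ σ (here refl)))

module Arcs {n : ℕ} (B : BurlingTree n) where
  open BurlingTree B
  open Ancestry tree

  private variable
    P : Fin n → Set
    a b v x y z : Fin n
    xs : List (Fin n)

  lastborn-sibling : x ≢ root → par (lb (par x)) ≡ par x × lb (par x) ≢ root
  lastborn-sibling {x} x≢r with lb-child (par x) (λ leaf → leaf x (x≢r , refl))
  ... | lb≢r , plb≡px = plb≡px , lb≢r

  arc-shape : y ∈ c x →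
    x ≢ root × lb (par x) ≢ x ×
    ∃[ t ] (c x ≡ lb (par x) ∷ t × IsBranch tree (lb (par x) ∷ t))
  arc-shape {x = x} y∈cx with x ≟ root
  ... | yes x≡r = ⊥-elim (∉-≡[] (c-empty x (inj₁ x≡r)) y∈cx)
  ... | no x≢r with lb (par x) ≟ x
  ...   | yes lb≡x = ⊥-elim (∉-≡[] (c-empty x (inj₂ (x≢r , lb≡x))) y∈cx)
  ...   | no lb≢x with c-branch x x≢r lb≢x
  ...     | _   , inj₁ cx≡[] = ⊥-elim (∉-≡[] cx≡[] y∈cx)
  ...     | isb , inj₂ hd with head≡just hd
  ...       | t , cx≡ = x≢r , lb≢x , t , cx≡ , subst (IsBranch tree) cx≡ isb

  arc-target-≽ : y ∈ c x → lb (par x) ≼ y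
  arc-target-≽ {y} y∈cx with arc-shape y∈cx
  ... | _ , _ , _ , cx≡ , isb = branch-head-≼ isb (subst (y ∈_) cx≡ y∈cx)

  arc-incomparable : y ∈ c x → ¬ Comparable x y
  arc-incomparable y∈cx x~y with arc-shape y∈cx
  ... | x≢r , lb≢x , _ with lastborn-sibling x≢r
  ...   | plb≡px , lb≢r with x~y
  ...     | inj₁ x≼y = siblings-no-common-descendant plb≡px lb≢x lb≢r x≢r
                         (arc-target-≽ y∈cx) x≼y
  ...     | inj₂ y≼x = siblings-no-common-descendant plb≡px lb≢x lb≢r x≢r
                         (≼-trans (arc-target-≽ y∈cx) y≼x) ≼-refl

  adjacent-incomparable : FAdj B x y → ¬ Comparable x y
  adjacent-incomparable (inj₁ y∈cx) = arc-incomparable y∈cx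
  adjacent-incomparable (inj₂ x∈cy) = arc-incomparable x∈cy ∘ swap

  arc-≺ : y ∈ c x → z ≺ x → z ≺ y
  arc-≺ {z = z} y∈cx (x≢r , z≼px) with lastborn-sibling x≢r
  ... | plb≡px , lb≢r =
    ≺-≼-trans (lb≢r , subst (z ≼_) (sym plb≡px) z≼px) (arc-target-≽ y∈cx)

  arc-ancestor : y ∈ c x → z ≼ y → z ∈ c x ⊎ z ≺ x
  arc-ancestor {y} {z = z} y∈cx z≼y with arc-shape y∈cx
  ... | x≢r , _ , _ , cx≡ , isb with branch-ancestor isb (subst (y ∈_) cx≡ y∈cx) z≼y
  ...   | inj₁ z∈ = inj₁ (subst (z ∈_) (sym cx≡) z∈)
  ...   | inj₂ (_ , z≼plb) =
    inj₂ (x≢r , subst (z ≼_) (proj₁ (lastborn-sibling x≢r)) z≼plb)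

  adjacent-≺ : FAdj B a b → v ≺ b → v ≺ a ⊎ FArc B a v
  adjacent-≺ (inj₁ b∈ca) v≺b = swap (arc-ancestor b∈ca (≺⇒≼ v≺b))
  adjacent-≺ (inj₂ a∈cb) v≺b = inj₁ (arc-≺ a∈cb v≺b)

  walk-≺ : Walk P (FAdj B) a b xs → v ≺ b → v ≺ a ⊎ ∃[ x ] (x ∈ xs × InNbr B P v x)
  walk-≺ (w-end _) v≺b = inj₁ v≺b
  walk-≺ (w-step Pa a~a′ rest) v≺b with walk-≺ rest v≺b
  ... | inj₂ (x , x∈ , x→v) = inj₂ (x , there x∈ , x→v)
  ... | inj₁ v≺a′ with adjacent-≺ a~a′ v≺a′
  ...   | inj₁ v≺a = inj₁ v≺a
  ...   | inj₂ a→v = inj₂ (_ , here refl , Pa , a→v)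

  walk-through-in-neighbour : a ≺ v → v ≺ b → Walk P (FAdj B) a b xs →
                              ∃[ x ] (x ∈ xs × InNbr B P v x)
  walk-through-in-neighbour a≺v v≺b walk with walk-≺ walk v≺b
  ... | inj₁ v≺a = ⊥-elim (≺-irrefl (≺-trans a≺v v≺a))
  ... | inj₂ x   = x

  ≺-∉-ClosedNbhd : {S : Fin n → Set} → x ≺ v ⊎ v ≺ x → ¬ ClosedNbhd B S v x
  ≺-∉-ClosedNbhd x≺v⊎v≺x (inj₁ refl)       = ≺-irrefl (reduce x≺v⊎v≺x)
  ≺-∉-ClosedNbhd x≺v⊎v≺x (inj₂ (_ , x~v)) =
    adjacent-incomparable x~v (⊎-map ≺⇒≼ ≺⇒≼ x≺v⊎v≺x)

  ClosedInNbhd⊆ClosedNbhd : {S : Fin n → Set} → ClosedInNbhd B S v x → ClosedNbhd B S v x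
  ClosedInNbhd⊆ClosedNbhd (inj₁ x≡v)        = inj₁ x≡v
  ClosedInNbhd⊆ClosedNbhd (inj₂ (Sx , x→v)) = inj₂ (Sx , inj₁ x→v)

  in-neighbours-separate : {S X : Fin n → Set} → a ≺ v → v ≺ b →
    (∀ {x} → InNbr B S v x → X x) → Minus S X a → Minus S X b →
    Separates S (FAdj B) X a b
  in-neighbours-separate a≺v v≺b InNbr⊆X a∈ b∈ = a∈ , b∈ , λ where
    (_ , walk , _) → let (_ , _ , (Sx , ¬Xx) , x→v) = walk-through-in-neighbour a≺v v≺b walk
                     in ¬Xx (InNbr⊆X (Sx , x→v))

lemma5p3 : ∀ {n : ℕ} (B : BurlingTree n) (S : Fin n → Set) (u v w : Fin n) →
    S u → S v → S w →
    (∃[ br ] (IsBranch (BurlingTree.tree B) br × ((u ∷ v ∷ w ∷ []) ⊆ br))) →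
    (∀ (xs : List (Fin n)) → IsPath S (FAdj B) u w xs →
       ∃[ x ] (x ∈ xs × InNbr B S v x))
    × Separates S (FAdj B) (ClosedInNbhd B S v) u w
    × Separates S (FAdj B) (ClosedNbhd B S v) u w
lemma5p3 B S u v w Su _ Sw (_ , isb , σ) =
    (λ _ (walk , _) → walk-through-in-neighbour u≺v v≺w walk)
  , in-neighbours-separate u≺v v≺w inj₂
      (Su , u∉N ∘ ClosedInNbhd⊆ClosedNbhd {S = S}) (Sw , w∉N ∘ ClosedInNbhd⊆ClosedNbhd {S = S})
  , in-neighbours-separate u≺v v≺w (inj₂ ∘ map₂ inj₁)
      (Su , u∉N) (Sw , w∉N)
  where
  open Ancestry (BurlingTree.tree B)
  open Arcs B
  u≺v : u ≺ v
  u≺v = branch-⊆⇒≺ isb σ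
  v≺w : v ≺ w
  v≺w = branch-⊆⇒≺ isb (∷ˡ⁻ σ)
  u∉N : ¬ ClosedNbhd B S v u
  u∉N = ≺-∉-ClosedNbhd {S = S} (inj₁ u≺v)
  w∉N : ¬ ClosedNbhd B S v w
  w∉N = ≺-∉-ClosedNbhd {S = S} (inj₂ v≺w)
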